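{- Let $\lambda,\mu\in DP$ with $D_\mu\subseteq D_\lambda$, let $k\ge2$ and let $T$ be a tableau of shape $D_{\lambda/\mu}$ such that either $c(T)_k=c(T)_{k-1}=0$, or else $T$ satisfies: (1) there is a box $(x,y)$ with $T(x,y)=k-1$ and $T(z,y)\ne k$ for all $z>x$; (2) if $T(x,y)=k$ then there is some $z<x$ with $T(z,y)=k-1$; (3) if $T(x,y)=k'$ then $T(x-1,y-1)=(k-1)'$; (4) $T^{(k-1)}$ is fitting; (5) if $c(T)_k>0$ then $T^{(k)}$ is fitting. Then $T$ is $k$-amenable.
   Context: $DP$: partitions with distinct parts $\lambda=(\lambda_1>\cdots>\lambda_n>0)$ (including $\emptyset$), $\ell(\lambda)=n$. $D_\lambda=\{(i,j):1\le i\le\ell(\lambda),\ i\le j\le i+\lambda_i-1\}$ (row $i$, column $j$, rows numbered downward); $D_{\lambda/\mu}=D_\lambda\setminus D_\mu$. Alphabet $1'<1<2'<2<\cdots$; $|x|$ is the unmarked version of $x$. A tableau of shape $D$ is a map $T:D\to$ alphabet with $T(i,j)\le T(i+1,j)$, $T(i,j)\le T(i,j+1)$ whenever the boxes lie in $D$, at most one unmarked $k$ per column and at most one marked $k'$ per row; $c(T)_i$ = number of entries in $\{i',i\}$. Reading word $w(T)=w_1\cdots w_n$, $n=|D_{\lambda/\mu}|$: rows read left to right, from the bottom row to the top row. $m_i(0)=0$; for $1\le j\le n$, $m_i(j)$ = number of occurrences of $i$ in $w_{n-j+1}\cdots w_n$; for $n+1\le j\le2n$, $m_i(j)=m_i(n)+$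 number of occurrences of $i'$ in $w_1\cdots w_{j-n}$. $k$-amenable: (a) for $0\le j\le n-1$, $m_k(j)=m_{k-1}(j)$ implies $w_{n-j}\notin\{k,k'\}$; (b) for $n\le j\le2n-1$, $m_k(j)=m_{k-1}(j)$ implies $w_{j-n+1}\notin\{k-1,k'\}$; (c) the first letter of $w$ in $\{k',k\}$ (if any) is $k$; (d) the first letter of $w$ in $\{(k-1)',k-1\}$ (if any) is $k-1$. A tableau is $k$-amenable if its reading word is. A border strip is an edgewise connected set $B$ of boxes with $(x,y)\in B\Rightarrow(x-1,y-1)\notin B$; its last box is $(u,v)\in B$ with $(u+1,v),(u,v-1)\notin B$. $T^{(i)}=\{(x,y):|T(x,y)|=i\}$; its components are border strips and its last box is the last box of its leftmost component; $T^{(i)}$ is fitting if its last box has entry $i$. -}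

module Defs where

open import Data.Nat using (ℕ; zero; suc; _+_; _*_; _∸_; _≤_; _<_; _>_; _≤ᵇ_; _<ᵇ_; _≡ᵇ_)
open import Data.Bool using (Bool; true; false; _∧_; not; T; T?; if_then_else_)
open import Data.List using (List; []; _∷_; length; map; filter; concatMap; upTo; downFrom; take; drop)
open import Data.List.Relation.Unary.All using (All)
open import Data.List.Relation.Unary.Linked using (Linked)
open import Data.Maybe using (Maybe; just; nothing)
open import Data.Product using (_×_; _,_; Σ; ∃; ∃-syntax)
open import Data.Sum using (_⊎_)
open import Relation.Binary.PropositionalEquality using (_≡_; _≢_)
open import Relation.Nullary using (¬_)

-- Strict partitions (distinct positive parts, strictly decreasing list)

IsDP : List ℕ → Set
IsDP λ' = Linked _>_ λ' × All (λ x → 0 < x) λ'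

-- λ_i, 1-based (0 outside 1..ℓ(λ))
part : List ℕ → ℕ → ℕ
part []       _             = 0
part (x ∷ xs) zero          = 0
part (x ∷ xs) (suc zero)    = x
part (x ∷ xs) (suc (suc i)) = part xs (suc i)

inDᵇ : List ℕ → ℕ → ℕ → Bool
inDᵇ λ' i j = (1 ≤ᵇ i) ∧ (i ≤ᵇ length λ') ∧ (i ≤ᵇ j) ∧ (j <ᵇ i + part λ' i)

InD : List ℕ → ℕ → ℕ → Set
InD λ' i j = T (inDᵇ λ' i j)

_⊆D_ : List ℕ → List ℕ → Set
μ ⊆D λ' = ∀ i j → InD μ i j → InD λ' i j

inSkewᵇ : List ℕ → List ℕ → ℕ → ℕ → Bool
inSkewᵇ λ' μ i j = inDᵇ λ' i j ∧ not (inDᵇ μ i j)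

InSkew : List ℕ → List ℕ → ℕ → ℕ → Set
InSkew λ' μ i j = T (inSkewᵇ λ' μ i j)

-- Alphabet 1' < 1 < 2' < 2 < ⋯ ; letter i false = i, letter i true = i'

record Letter : Set where
  constructor letter
  field
    num    : ℕ
    primed : Bool
open Letter public

-- i' ↦ 2i-1, i ↦ 2i (order-embedding for i ≥ 1)
rank : Letter → ℕ
rank (letter n false) = 2 * n
rank (letter n true)  = 2 * n ∸ 1

_≤L_ : Letter → Letter → Set
a ≤L b = rank a ≤ rank b

-- Tableaux of shape D_{λ/μ}; T is given as a map on ℕ × ℕ (row, column),
-- only its values on D_{λ/μ} matter.

Filling : Set
Filling = ℕ → ℕ → Letter

record IsTableau (λ' μ : List ℕ) (Tb : Filling) : Set where
  field
    inAlphabet : ∀ i j → InSkew λ' μ i j → 1 ≤ num (Tb i j)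
    colWeak    : ∀ i j → InSkew λ' μ i j → InSkew λ' μ (suc i) j →
                 Tb i j ≤L Tb (suc i) j
    rowWeak    : ∀ i j → InSkew λ' μ i j → InSkew λ' μ i (suc j) →
                 Tb i j ≤L Tb i (suc j)
    unmarkedCol : ∀ i i' j → InSkew λ' μ i j → InSkew λ' μ i' j →
                  Tb i j ≡ Tb i' j → primed (Tb i j) ≡ false → i ≡ i'
    markedRow   : ∀ i j j' → InSkew λ' μ i j → InSkew λ' μ i j' →
                  Tb i j ≡ Tb i j' → primed (Tb i j) ≡ true → j ≡ j'

rowWord : List ℕ → List ℕ → Filling → ℕ → List Letter
rowWord λ' μ Tb i =
  map (Tb i) (filter (λ j → T? (inSkewᵇ λ' μ i j)) (map (i +_) (upTo (part λ' i))))

readingWord : List ℕ → List ℕ → Filling → List Letter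
readingWord λ' μ Tb = concatMap (rowWord λ' μ Tb) (map suc (downFrom (length λ')))

countᵇ : (Letter → Bool) → List Letter → ℕ
countᵇ p []       = 0
countᵇ p (x ∷ xs) = if p x then suc (countᵇ p xs) else countᵇ p xs

isNum : ℕ → Letter → Bool
isNum i l = num l ≡ᵇ i

isUnmarked : ℕ → Letter → Bool
isUnmarked i l = (num l ≡ᵇ i) ∧ not (primed l)

isMarked : ℕ → Letter → Bool
isMarked i l = (num l ≡ᵇ i) ∧ primed l

-- c(T)_i : number of entries in {i', i}  (every box occurs exactly once in the word)
content : List ℕ → List ℕ → Filling → ℕ → ℕ
content λ' μ Tb i = countᵇ (isNum i) (readingWord λ' μ Tb)

-- w_p, 1-based (dummy value outside 1..n)
at : List Letter → ℕ → Letter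
at []       _             = letter 0 false
at (x ∷ xs) zero          = letter 0 false
at (x ∷ xs) (suc zero)    = x
at (x ∷ xs) (suc (suc p)) = at xs (suc p)

mcount : List Letter → ℕ → ℕ → ℕ
mcount w i j =
  if j ≤ᵇ length w
  then countᵇ (isUnmarked i) (drop (length w ∸ j) w)
  else countᵇ (isUnmarked i) w + countᵇ (isMarked i) (take (j ∸ length w) w)

firstWith : (Letter → Bool) → List Letter → Maybe Letter
firstWith p []       = nothing
firstWith p (x ∷ xs) = if p x then just x else firstWith p xs

record Amenable (k : ℕ) (w : List Letter) : Set where
  field
    condA : ∀ j → j < length w → mcount w k j ≡ mcount w (k ∸ 1) j →
            num (at w (length w ∸ j)) ≢ k
    condB : ∀ j → length w ≤ j → j < 2 * length w →
            mcount w k j ≡ mcount w (k ∸ 1) j →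
            (at w (suc (j ∸ length w)) ≢ letter (k ∸ 1) false) ×
            (at w (suc (j ∸ length w)) ≢ letter k true)
    condC : ∀ l → firstWith (isNum k) w ≡ just l → primed l ≡ false
    condD : ∀ l → firstWith (isNum (k ∸ 1)) w ≡ just l → primed l ≡ false

TabAmenable : ℕ → List ℕ → List ℕ → Filling → Set
TabAmenable k λ' μ Tb = Amenable k (readingWord λ' μ Tb)

Box : Set
Box = ℕ × ℕ

Adj : Box → Box → Set
Adj (x , y) (x' , y') =
  (x ≡ x' × (suc y ≡ y' ⊎ y ≡ suc y')) ⊎ (y ≡ y' × (suc x ≡ x' ⊎ x ≡ suc x'))

data Reach (S : Box → Set) (a : Box) : Box → Set where
  here : S a → Reach S a a
  step : ∀ {b c} → Reach S a b → Adj b c → S c → Reach S a c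

Level : List ℕ → List ℕ → Filling → ℕ → Box → Set
Level λ' μ Tb i (x , y) = InSkew λ' μ x y × num (Tb x y) ≡ i

-- the component of a in S is the leftmost one: it contains a box whose
-- column is minimal among all boxes of S
LeftmostComp : (Box → Set) → Box → Set
LeftmostComp S a = Σ Box λ b → Reach S a b × (∀ c → S c → Data.Product.proj₂ b ≤ Data.Product.proj₂ c)

LastBox : (Box → Set) → Box → Set
LastBox S (u , v) =
  S (u , v) × LeftmostComp S (u , v) ×
  ¬ Reach S (u , v) (suc u , v) × ¬ Reach S (u , v) (u , v ∸ 1)

Fitting : List ℕ → List ℕ → Filling → ℕ → Set
Fitting λ' μ Tb i =
  Σ Box λ b → LastBox (Level λ' μ Tb i) b ×
    Tb (Data.Product.proj₁ b) (Data.Product.proj₂ b) ≡ letter i false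

record Conditions (k : ℕ) (λ' μ : List ℕ) (Tb : Filling) : Set where
  field
    cond1 : ∃[ x ] ∃[ y ] (InSkew λ' μ x y × Tb x y ≡ letter (k ∸ 1) false ×
              (∀ z → x < z → InSkew λ' μ z y → Tb z y ≢ letter k false))
    cond2 : ∀ x y → InSkew λ' μ x y → Tb x y ≡ letter k false →
              ∃[ z ] (z < x × InSkew λ' μ z y × Tb z y ≡ letter (k ∸ 1) false)
    cond3 : ∀ x y → InSkew λ' μ x y → Tb x y ≡ letter k true →
              InSkew λ' μ (x ∸ 1) (y ∸ 1) × Tb (x ∸ 1) (y ∸ 1) ≡ letter (k ∸ 1) true
    cond4 : Fitting λ' μ Tb (k ∸ 1)
    cond5 : 0 < content λ' μ Tb k → Fitting λ' μ Tb k

-- Write k = a + 1 and list the boxes of D_{λ/μ} in reading order, so that the reading word is the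
-- image of this list under T. A count m_i(j) then counts boxes read after the box of w_{n-j}
-- (j < n), or all boxes together with the marked ones read before the box of w_{j-n+1} (j ≥ n).
-- The inequalities behind (a) and (b) come from injections: by (2) every unmarked k has an
-- unmarked a above it in its column, and by (3) every k' has an a' diagonally above-left of it.
-- One more unmarked a is not hit: in (b) the box of condition (1); in (a) the unmarked a above the
-- box of w_{n-j} in its column, which exists by (2) or, for a k', by climbing the column through
-- boxes filled with k' (each step uses (3)). For (c) and (d): a level set T^(i) never contains
-- (x,y), (x,y+1), (x+1,y+1), so the component of its last box lies weakly north-east of that box;
-- the first box of T^(i) in reading order therefore lies weakly south-east of the last box of the
-- leftmost component, and fitting forces it to carry an unmarked i. When c(T)_k = c(T)_{k-1} = 0,
-- all four conditions hold vacuously.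

module Submission where

open import Defs
open import Data.Bool using (Bool; true; false; T; T?; not; if_then_else_)
open import Data.Bool.Properties using (T-≡; T-∧; T-not-≡)
open import Data.Empty using (⊥; ⊥-elim)
open import Data.List
  using (List; []; _∷_; _++_; map; concat; concatMap; filter; upTo; downFrom; length; take; drop)
open import Data.List.Properties using (map-∘; map-cong; map-concatMap)
open import Data.List.Membership.Propositional using (_∈_; lose)
open import Data.List.Membership.Propositional.Properties
  using (∈-∃++; ∈-++⁻; ∈-++⁺ˡ; ∈-++⁺ʳ; ∈-map⁺; ∈-map⁻; ∈-filter⁺; ∈-filter⁻; ∈-upTo⁺; ∈-downFrom⁺;
         ∈-concatMap⁺; ∈-concatMap⁻)
open import Data.List.Relation.Unary.All as All using (All; []; _∷_)
open import Data.List.Relation.Unary.All.Properties using (++⁻ˡ; ++⁻ʳ) renaming (map⁺ to All-map⁺)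
open import Data.List.Relation.Unary.AllPairs as AllPairs using (AllPairs; []; _∷_)
import Data.List.Relation.Unary.AllPairs.Properties as AllPairsₚ
open import Data.List.Relation.Unary.Any using (here; there; satisfied)
open import Data.List.Relation.Unary.Linked as Linked using (Linked)
open import Data.List.Relation.Unary.Unique.Propositional using (Unique)
open import Data.Maybe using (just)
open import Data.Maybe.Properties using (just-injective)
open import Data.Nat using (ℕ; zero; suc; _+_; _*_; _∸_; _≤_; _<_; _>_; _≤?_; _≤ᵇ_; z≤n; s≤s)
open import Data.Nat.Properties
open import Data.Product using (∃-syntax; _×_; _,_; proj₁; proj₂; uncurry)
open import Data.Product.Relation.Binary.Lex.Strict using (×-Lex; ×-asymmetric; ×-transitive)
open import Data.Sum using (_⊎_; inj₁; inj₂)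
open import Function using (id; _∘_; case_of_)
open import Function.Bundles using (module Equivalence)
open Equivalence using (to; from)
open import Relation.Binary.Definitions using (tri<; tri≈; tri>)
open import Relation.Binary.PropositionalEquality
open import Relation.Nullary using (¬_; yes; no)

-- Counting along an injection

count : {A : Set} → (A → Bool) → List A → ℕ
count p []       = 0
count p (x ∷ xs) = if p x then suc (count p xs) else count p xs

countᵇ-map : {A : Set} (p : Letter → Bool) (f : A → Letter) (xs : List A) →
             countᵇ p (map f xs) ≡ count (p ∘ f) xs
countᵇ-map p f []       = refl
countᵇ-map p f (x ∷ xs) with p (f x)
... | true  = cong suc (countᵇ-map p f xs)
... | false = countᵇ-map p f xs

module _ {A : Set} where

  count-++-∷ : (p : A → Bool) (ys : List A) {e : A} (zs : List A) → T (p e) →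
               count p (ys ++ e ∷ zs) ≡ suc (count p (ys ++ zs))
  count-++-∷ p []       {e} zs pe with p e
  ... | true = refl
  count-++-∷ p (y ∷ ys) zs pe with p y
  ... | true  = cong suc (count-++-∷ p ys zs pe)
  ... | false = count-++-∷ p ys zs pe

  ∈-++-∷⁻ : ∀ {x e} (ys zs : List A) → x ∈ ys ++ e ∷ zs → x ≢ e → x ∈ ys ++ zs
  ∈-++-∷⁻ ys zs x∈ x≢e with ∈-++⁻ ys x∈
  ... | inj₁ x∈ys         = ∈-++⁺ˡ x∈ys
  ... | inj₂ (here x≡e)   = ⊥-elim (x≢e x≡e)
  ... | inj₂ (there x∈zs) = ∈-++⁺ʳ ys x∈zs

  record Matching (P Q : A → Bool) (R : A → A → Set) (xs ys : List A) : Set where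
    field
      partner           : ∀ {x} → x ∈ xs → T (P x) → ∃[ y ] (y ∈ ys × T (Q y) × R x y)
      partner-injective : ∀ {x x' y} → x ∈ xs → x' ∈ xs → T (P x) → T (P x') →
                          R x y → R x' y → x ≡ x'

  module _ {P Q : A → Bool} {R : A → A → Set} where

    Matching-without : ∀ {xs} ys {e} zs → Matching P Q R xs (ys ++ e ∷ zs) →
                       (∀ {x} → x ∈ xs → T (P x) → ¬ R x e) → Matching P Q R xs (ys ++ zs)
    Matching-without ys zs m unrelated = record
      { partner           = λ x∈ px → let y , y∈ , qy , rxy = partner x∈ px in
          y , ∈-++-∷⁻ ys zs y∈ (λ y≡e → unrelated x∈ px (subst (R _) y≡e rxy)) , qy , rxy
      ; partner-injective = partner-injective
      }
      where open Matching m

    Matching-tail : ∀ {x xs ys} → Matching P Q R (x ∷ xs) ys → Matching P Q R xs ys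
    Matching-tail m = record
      { partner           = partner ∘ there
      ; partner-injective = λ x∈ x'∈ → partner-injective (there x∈) (there x'∈)
      }
      where open Matching m

    count-≤ : ∀ {xs ys} → Unique xs → Matching P Q R xs ys → count P xs ≤ count Q ys
    count-≤ {[]}     _            _ = z≤n
    count-≤ {x ∷ xs} (x∉xs ∷ uxs) m with P x in px
    ... | false = count-≤ uxs (Matching-tail m)
    ... | true with Matching.partner m (here refl) (from T-≡ px)
    ... | y , y∈ys , qy , rxy with ∈-∃++ y∈ys
    ... | ys₁ , ys₂ , refl rewrite count-++-∷ Q ys₁ ys₂ qy =
      s≤s (count-≤ uxs (Matching-without ys₁ ys₂ (Matching-tail m) unrelated))
      where
      unrelated : ∀ {x'} → x' ∈ xs → T (P x') → ¬ R x' y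
      unrelated x'∈ px' rx'y = All.lookup x∉xs x'∈
        (Matching.partner-injective m (here refl) (there x'∈) (from T-≡ px) px' rxy rx'y)

    count-< : ∀ {xs ys e} → Unique xs → Matching P Q R xs ys → e ∈ ys → T (Q e) →
              (∀ {x} → x ∈ xs → T (P x) → ¬ R x e) → suc (count P xs) ≤ count Q ys
    count-< uxs m e∈ys qe unrelated with ∈-∃++ e∈ys
    ... | ys₁ , ys₂ , refl rewrite count-++-∷ Q ys₁ ys₂ qe =
      s≤s (count-≤ uxs (Matching-without ys₁ ys₂ m unrelated))

-- Strictly sorted lists split at a pivot

module _ {A : Set} {_<_ : A → A → Set} where

  AllPairs-++⁻ : ∀ xs {ys} → AllPairs _<_ (xs ++ ys) → AllPairs _<_ xs × AllPairs _<_ ys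
  AllPairs-++⁻ []       ps       = [] , ps
  AllPairs-++⁻ (x ∷ xs) (p ∷ ps) =
    ++⁻ˡ xs p ∷ proj₁ (AllPairs-++⁻ xs ps) , proj₂ (AllPairs-++⁻ xs ps)

  AllPairs-before-pivot : ∀ pre {q post} → AllPairs _<_ (pre ++ q ∷ post) → All (_< q) pre
  AllPairs-before-pivot []        _        = []
  AllPairs-before-pivot (x ∷ pre) (p ∷ ps) =
    All.head (++⁻ʳ pre p) ∷ AllPairs-before-pivot pre ps

  AllPairs-after-pivot : ∀ pre {q post} → AllPairs _<_ (pre ++ q ∷ post) → All (q <_) post
  AllPairs-after-pivot pre ps = AllPairs.head (proj₂ (AllPairs-++⁻ pre ps))

  module _ (<-asym : ∀ {x y} → x < y → ¬ y < x) where

    AllPairs⇒Unique : ∀ {xs} → AllPairs _<_ xs → Unique xs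
    AllPairs⇒Unique = AllPairs.map λ { x<y refl → <-asym x<y x<y }

    ∈-after-pivot : ∀ pre {q post r} → AllPairs _<_ (pre ++ q ∷ post) →
                    r ∈ pre ++ q ∷ post → q < r → r ∈ post
    ∈-after-pivot pre ps r∈ q<r with ∈-++⁻ pre r∈
    ... | inj₁ r∈pre          = ⊥-elim (<-asym q<r (All.lookup (AllPairs-before-pivot pre ps) r∈pre))
    ... | inj₂ (here refl)    = ⊥-elim (<-asym q<r q<r)
    ... | inj₂ (there r∈post) = r∈post

    ∈-before-pivot : ∀ pre {q post r} → AllPairs _<_ (pre ++ q ∷ post) →
                     r ∈ pre ++ q ∷ post → r < q → r ∈ pre
    ∈-before-pivot pre ps r∈ r<q with ∈-++⁻ pre r∈
    ... | inj₁ r∈pre          = r∈pre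
    ... | inj₂ (here refl)    = ⊥-elim (<-asym r<q r<q)
    ... | inj₂ (there r∈post) = ⊥-elim (<-asym r<q (All.lookup (AllPairs-after-pivot pre ps) r∈post))

rank-marked-suc : ∀ n → rank (letter (suc n) true) ≡ suc (rank (letter n false))
rank-marked-suc n = +-suc n (n + 0)

marked<unmarked : ∀ {n} → 1 ≤ n → rank (letter n true) < rank (letter n false)
marked<unmarked {suc n} _ = ≤-refl

unmarked≤next-marked : ∀ a → letter a false ≤L letter (suc a) true
unmarked≤next-marked a = ≤-trans (n≤1+n _) (≤-reflexive (sym (rank-marked-suc a)))

letter-bounds : ∀ L → letter (num L) true ≤L L × L ≤L letter (num L) false
letter-bounds (letter n false) = m∸n≤m (2 * n) 1 , ≤-refl
letter-bounds (letter n true)  = ≤-refl , m∸n≤m (2 * n) 1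

num-<⇒rank-< : ∀ {L L'} → num L < num L' → rank L < rank L'
num-<⇒rank-< {L} {L'} n<n' = begin-strict
  rank L                           ≤⟨ proj₂ (letter-bounds L) ⟩
  rank (letter (num L) false)      <⟨ ≤-reflexive (sym (rank-marked-suc (num L))) ⟩
  rank (letter (suc (num L)) true) ≤⟨ ∸-monoˡ-≤ 1 (*-monoʳ-≤ 2 n<n') ⟩
  rank (letter (num L') true)      ≤⟨ proj₁ (letter-bounds L') ⟩
  rank L'                          ∎
  where open ≤-Reasoning

num-mono : ∀ {L L'} → L ≤L L' → num L ≤ num L'
num-mono {L} {L'} L≤L' = ≮⇒≥ λ n'<n → <⇒≱ (num-<⇒rank-< {L'} {L} n'<n) L≤L'

≤L-antisym : ∀ {L L'} → 1 ≤ num L → L ≤L L' → L' ≤L L → L ≡ L'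
≤L-antisym {letter n p} {letter n' p'} 1≤n L≤L' L'≤L
  with ≤-antisym (num-mono {letter n p} {letter n' p'} L≤L') (num-mono {letter n' p'} {letter n p} L'≤L)
≤L-antisym {letter n false} {letter .n false} _ _ _ | refl = refl
≤L-antisym {letter n true}  {letter .n true}  _ _ _ | refl = refl
≤L-antisym {letter n false} {letter .n true}  1≤n L≤L' _ | refl =
  ⊥-elim (<⇒≱ (marked<unmarked 1≤n) L≤L')
≤L-antisym {letter n true}  {letter .n false} 1≤n _ L'≤L | refl =
  ⊥-elim (<⇒≱ (marked<unmarked 1≤n) L'≤L)

unmarked-if-≥ : ∀ {L i} → 1 ≤ i → num L ≡ i → letter i false ≤L L → L ≡ letter i false
unmarked-if-≥ {L} 1≤i refl i≤L = ≤L-antisym 1≤i (proj₂ (letter-bounds L)) i≤L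

marked-if-≤ : ∀ {L i} → 1 ≤ i → num L ≡ i → L ≤L letter i true → L ≡ letter i true
marked-if-≤ {L} 1≤i refl L≤i' = sym (≤L-antisym 1≤i (proj₁ (letter-bounds L)) L≤i')

num-squeeze : ∀ {L₁ L L₂ i} → L₁ ≤L L → L ≤L L₂ → num L₁ ≡ i → num L₂ ≡ i → num L ≡ i
num-squeeze {L₁} {L} {L₂} L₁≤L L≤L₂ refl refl =
  ≤-antisym (num-mono {L} {L₂} L≤L₂) (num-mono {L₁} {L} L₁≤L)

between-marked : ∀ {a L} → letter a true ≤L L → L ≤L letter (suc a) true → L ≢ letter a true →
                 L ≡ letter a false ⊎ L ≡ letter (suc a) true
between-marked {a} {letter n p} lo hi ≢a' with m≤n⇒m<n∨m≡n (num-mono {letter a true} {letter n p} lo)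
... | inj₁ a<n =
  inj₂ (marked-if-≤ (s≤s z≤n) (≤-antisym (num-mono {letter n p} {letter (suc a) true} hi) a<n) hi)
between-marked {a} {letter .a false} lo hi ≢a' | inj₂ refl = inj₁ refl
between-marked {a} {letter .a true}  lo hi ≢a' | inj₂ refl = ⊥-elim (≢a' refl)

between-unmarked-next-marked : ∀ {a L} → L ≡ letter a false ⊎ L ≡ letter (suc a) true →
                               letter a false ≤L L × L ≤L letter (suc a) true
between-unmarked-next-marked {a} (inj₁ refl) = ≤-refl , unmarked≤next-marked a
between-unmarked-next-marked {a} (inj₂ refl) = unmarked≤next-marked a , ≤-refl

letter-η : ∀ {L i p} → num L ≡ i → primed L ≡ p → L ≡ letter i p
letter-η refl refl = refl

isNum⁺ : ∀ {i} L → num L ≡ i → T (isNum i L)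
isNum⁺ {i} L = ≡⇒≡ᵇ (num L) i

isNum⁻ : ∀ {i} L → T (isNum i L) → num L ≡ i
isNum⁻ {i} L = ≡ᵇ⇒≡ (num L) i

isUnmarked⁺ : ∀ {i L} → L ≡ letter i false → T (isUnmarked i L)
isUnmarked⁺ {i} refl = from T-∧ (≡⇒≡ᵇ i i refl , _)

isUnmarked⁻ : ∀ {i L} → T (isUnmarked i L) → L ≡ letter i false
isUnmarked⁻ {i} {letter n p} t with to T-∧ t
... | n≡i , ¬p rewrite ≡ᵇ⇒≡ n i n≡i | to T-not-≡ ¬p = refl

isMarked⁺ : ∀ {i L} → L ≡ letter i true → T (isMarked i L)
isMarked⁺ {i} refl = from T-∧ (≡⇒≡ᵇ i i refl , _)

isMarked⁻ : ∀ {i L} → T (isMarked i L) → L ≡ letter i true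
isMarked⁻ {i} {letter n p} t with to T-∧ t
... | n≡i , p≡true rewrite ≡ᵇ⇒≡ n i n≡i | to T-≡ p≡true = refl

absent-∉ : ∀ (p : Letter → Bool) {x} w → countᵇ p w ≡ 0 → x ∈ w → ¬ T (p x)
absent-∉ p (y ∷ w) none (here refl) px with p y
... | true = case none of λ ()
absent-∉ p (y ∷ w) none (there x∈w) px with p y
... | true  = case none of λ ()
... | false = absent-∉ p w none x∈w px

at-∈ : ∀ w {p} → 1 ≤ p → p ≤ length w → at w p ∈ w
at-∈ (x ∷ w) {suc zero}    _ _          = here refl
at-∈ (x ∷ w) {suc (suc p)} _ (s≤s p<n) = there (at-∈ w (s≤s z≤n) p<n)

firstWith-∈ : ∀ (p : Letter → Bool) w {l} → firstWith p w ≡ just l → l ∈ w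
firstWith-∈ p (x ∷ w) found with p x
... | true  = here (sym (just-injective found))
... | false = there (firstWith-∈ p w found)

firstWith-holds : ∀ (p : Letter → Bool) w {l} → firstWith p w ≡ just l → T (p l)
firstWith-holds p (x ∷ w) found with p x in px
... | true  = subst (T ∘ p) (just-injective found) (from T-≡ px)
... | false = firstWith-holds p w found

firstWith⇒countᵇ>0 : ∀ (p : Letter → Bool) w {l} → firstWith p w ≡ just l → 0 < countᵇ p w
firstWith⇒countᵇ>0 p w found =
  n≢0⇒n>0 λ none → absent-∉ p w none (firstWith-∈ p w found) (firstWith-holds p w found)

firstWith-map : {A : Set} (p : Letter → Bool) (F : A → Letter) (bs : List A) {l : Letter} →
                firstWith p (map F bs) ≡ just l →
                ∃[ pre ] ∃[ q ] ∃[ post ]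
                  (bs ≡ pre ++ q ∷ post × F q ≡ l × All (λ r → ¬ T (p (F r))) pre)
firstWith-map p F (b ∷ bs) found with p (F b) in pb
... | true  = [] , b , bs , refl , just-injective found , []
... | false with firstWith-map p F bs found
... | pre , q , post , refl , Fq≡l , none =
  b ∷ pre , q , post , refl , Fq≡l , (λ pb' → subst T pb pb') ∷ none

record PivotAt {A : Set} (F : A → Letter) (bs : List A) (i : ℕ) : Set where
  field
    before : List A
    pivot  : A
    after  : List A
    split  : bs ≡ before ++ pivot ∷ after
    take≡  : take i (map F bs) ≡ map F before
    drop≡  : drop (suc i) (map F bs) ≡ map F after
    at≡    : at (map F bs) (suc i) ≡ F pivot

pivotAt : {A : Set} (F : A → Letter) (bs : List A) (i : ℕ) → i < length (map F bs) → PivotAt F bs i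
pivotAt F (b ∷ bs) zero    _ = record
  { before = [] ; pivot = b ; after = bs ; split = refl ; take≡ = refl ; drop≡ = refl ; at≡ = refl }
pivotAt F (b ∷ bs) (suc i) (s≤s i<n) = record
  { before = b ∷ before ; pivot = pivot ; after = after ; split = cong (b ∷_) split
  ; take≡ = cong (F b ∷_) take≡ ; drop≡ = drop≡ ; at≡ = at≡ }
  where open PivotAt (pivotAt F bs i i<n)

mcount-suffix : ∀ w i {j} → j ≤ length w →
                mcount w i j ≡ countᵇ (isUnmarked i) (drop (length w ∸ j) w)
mcount-suffix w i {j} j≤n with j ≤ᵇ length w in eq
... | true  = refl
... | false = case subst T eq (≤⇒≤ᵇ j≤n) of λ ()

mcount-prefix : ∀ w i {j} → length w ≤ j →
                mcount w i j ≡ countᵇ (isUnmarked i) w + countᵇ (isMarked i) (take (j ∸ length w) w)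
mcount-prefix w i {j} n≤j with j ≤ᵇ length w in eq
... | false = refl
... | true rewrite ≤-antisym (≤ᵇ⇒≤ j (length w) (from T-≡ eq)) n≤j | n∸n≡0 (length w) =
  sym (+-identityʳ _)

∸≡suc∸suc : ∀ {n j} → j < n → n ∸ j ≡ suc (n ∸ suc j)
∸≡suc∸suc {suc n} {zero}  _         = refl
∸≡suc∸suc {suc n} {suc j} (s≤s j<n) = ∸≡suc∸suc j<n

∸suc< : ∀ {n j} → j < n → n ∸ suc j < n
∸suc< {n} {j} j<n = subst (_≤ n) (∸≡suc∸suc j<n) (m∸n≤m n j)

∸<-of-<2* : ∀ {n j} → n ≤ j → j < 2 * n → j ∸ n < n
∸<-of-<2* {n} {j} n≤j j<2n =
  subst (j ∸ n <_) (trans (m+n∸m≡n n (n + 0)) (+-identityʳ n)) (∸-monoˡ-< j<2n n≤j)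

amenable-if-absent : ∀ k w → countᵇ (isNum k) w ≡ 0 → countᵇ (isNum (k ∸ 1)) w ≡ 0 → Amenable k w
amenable-if-absent k w no-k no-k-1 = record
  { condA = λ j j<n _ numk →
      absent-∉ (isNum k) w no-k (at-∈ w (m<n⇒0<n∸m j<n) (m∸n≤m (length w) j))
               (isNum⁺ (at w (length w ∸ j)) numk)
  ; condB = λ j n≤j j<2n _ →
      let x = at w (suc (j ∸ length w)) ; x∈w = at-∈ w (s≤s z≤n) (∸<-of-<2* n≤j j<2n) in
      (λ eq → absent-∉ (isNum (k ∸ 1)) w no-k-1 x∈w (isNum⁺ x (cong num eq))) ,
      (λ eq → absent-∉ (isNum k) w no-k x∈w (isNum⁺ x (cong num eq)))
  ; condC = λ _ found → ⊥-elim (<-irrefl (sym no-k) (firstWith⇒countᵇ>0 (isNum k) w found))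
  ; condD = λ _ found → ⊥-elim (<-irrefl (sym no-k-1) (firstWith⇒countᵇ>0 (isNum (k ∸ 1)) w found))
  }

-- Skew shapes of strict partitions

T-not⁻ : ∀ {b} → T (not b) → ¬ T b
T-not⁻ {false} _ ()

T-not⁺ : ∀ {b} → ¬ T b → T (not b)
T-not⁺ {false} _  = _
T-not⁺ {true}  ¬t = ¬t _

record InShape (ν : List ℕ) (i j : ℕ) : Set where
  field
    row-pos : 1 ≤ i
    row≤len : i ≤ length ν
    row≤col : i ≤ j
    col<end : j < i + part ν i

inShape⁻ : ∀ {ν i j} → InD ν i j → InShape ν i j
inShape⁻ {ν} {i} {j} t =
  let t₁ , t₂₃₄ = to T-∧ t ; t₂ , t₃₄ = to T-∧ t₂₃₄ ; t₃ , t₄ = to T-∧ t₃₄ in record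
  { row-pos = ≤ᵇ⇒≤ 1 i t₁ ; row≤len = ≤ᵇ⇒≤ i (length ν) t₂
  ; row≤col = ≤ᵇ⇒≤ i j t₃ ; col<end = <ᵇ⇒< j (i + part ν i) t₄ }

inShape⁺ : ∀ {ν i j} → InShape ν i j → InD ν i j
inShape⁺ s = from T-∧ (≤⇒≤ᵇ row-pos , from T-∧ (≤⇒≤ᵇ row≤len , from T-∧ (≤⇒≤ᵇ row≤col , <⇒<ᵇ col<end)))
  where open InShape s

inSkew⁻ : ∀ {lam mu i j} → InSkew lam mu i j → InShape lam i j × ¬ InShape mu i j
inSkew⁻ {lam} {mu} {i} {j} t with to T-∧ t
... | inLam , notInMu = inShape⁻ inLam , T-not⁻ notInMu ∘ inShape⁺ {mu} {i} {j}

inSkew⁺ : ∀ {lam mu i j} → InShape lam i j → ¬ InShape mu i j → InSkew lam mu i j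
inSkew⁺ {lam} {mu} {i} {j} inLam notInMu =
  from T-∧ (inShape⁺ inLam , T-not⁺ (notInMu ∘ inShape⁻ {mu} {i} {j}))

part-strict : ∀ {ν i} → Linked _>_ ν → 1 ≤ i → suc i ≤ length ν → part ν (suc i) < part ν i
part-strict {x ∷ y ∷ ν} {suc zero}    ν-strict _ _           = Linked.head ν-strict
part-strict {x ∷ y ∷ ν} {suc (suc i)} ν-strict _ (s≤s i<len) =
  part-strict (Linked.tail ν-strict) (s≤s z≤n) i<len
part-strict {x ∷ []}    {suc zero}    _        _ (s≤s ())

rowEnd-antitone : ∀ {ν i i'} → Linked _>_ ν → 1 ≤ i → i ≤ i' → i' ≤ length ν →
                  i' + part ν i' ≤ i + part ν i
rowEnd-antitone {ν} {i} {i'} ν-strict 1≤i i≤i' i'≤len with m≤n⇒m<n∨m≡n i≤i'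
... | inj₂ refl = ≤-refl
rowEnd-antitone {ν} {i} {suc m} ν-strict 1≤i _ i'≤len | inj₁ (s≤s i≤m) = begin
  suc m + part ν (suc m)   ≡⟨ sym (+-suc m _) ⟩
  m + suc (part ν (suc m)) ≤⟨ +-monoʳ-≤ m (part-strict ν-strict (≤-trans 1≤i i≤m) i'≤len) ⟩
  m + part ν m             ≤⟨ rowEnd-antitone ν-strict 1≤i i≤m (≤-trans (n≤1+n m) i'≤len) ⟩
  i + part ν i             ∎
  where open ≤-Reasoning

module Shape {lam mu : List ℕ} (lam-strict : Linked _>_ lam) (mu-strict : Linked _>_ mu) where

  -- A wrapper, so that the coordinates can be inferred from a proof of membership.
  record Skew (x y : ℕ) : Set where
    constructor skew
    field inSkew : InSkew lam mu x y
  open Skew public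

  skew-convex : ∀ {x₁ y₁ x₂ y₂ x y} → Skew x₁ y₁ → Skew x₂ y₂ →
                x₁ ≤ x → x ≤ x₂ → y₁ ≤ y → y ≤ y₂ → x ≤ y → Skew x y
  skew-convex {x₁} {y₁} {x₂} {y₂} {x} {y} (skew s₁) (skew s₂) x₁≤x x≤x₂ y₁≤y y≤y₂ x≤y =
    skew (inSkew⁺ {lam} {mu} {x} {y} inLam notInMu)
    where
    open InShape
    lam₁ = proj₁ (inSkew⁻ {lam} {mu} {x₁} {y₁} s₁)
    lam₂ = proj₁ (inSkew⁻ {lam} {mu} {x₂} {y₂} s₂)
    1≤x = ≤-trans (row-pos lam₁) x₁≤x
    inLam : InShape lam x y
    inLam = record
      { row-pos = 1≤x ; row≤len = ≤-trans x≤x₂ (row≤len lam₂) ; row≤col = x≤y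
      ; col<end = ≤-trans (s≤s y≤y₂) (≤-trans (col<end lam₂)
                    (rowEnd-antitone lam-strict 1≤x x≤x₂ (row≤len lam₂))) }
    notInMu : ¬ InShape mu x y
    notInMu inMu = proj₂ (inSkew⁻ {lam} {mu} {x₁} {y₁} s₁) record
      { row-pos = row-pos lam₁ ; row≤len = ≤-trans x₁≤x (row≤len inMu) ; row≤col = row≤col lam₁
      ; col<end = ≤-trans (s≤s y₁≤y) (≤-trans (col<end inMu)
                    (rowEnd-antitone mu-strict (row-pos lam₁) x₁≤x (row≤len inMu))) }

  skew-inShape : ∀ {x y} → Skew x y → InShape lam x y
  skew-inShape {x} {y} (skew s) = proj₁ (inSkew⁻ {lam} {mu} {x} {y} s)

  skew-row≤col : ∀ {x y} → Skew x y → x ≤ y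
  skew-row≤col = InShape.row≤col ∘ skew-inShape

  skew-pos : ∀ {x y} → Skew x y → 1 ≤ x × 1 ≤ y
  skew-pos s = row-pos , ≤-trans row-pos row≤col
    where open InShape (skew-inShape s)

  diagonal-injective : ∀ {x y x' y'} → Skew x y → Skew x' y' →
                       (x ∸ 1 , y ∸ 1) ≡ (x' ∸ 1 , y' ∸ 1) → (x , y) ≡ (x' , y')
  diagonal-injective s s' eq = cong₂ _,_
    (∸-cancelʳ-≡ (proj₁ (skew-pos s)) (proj₁ (skew-pos s')) (cong proj₁ eq))
    (∸-cancelʳ-≡ (proj₂ (skew-pos s)) (proj₂ (skew-pos s')) (cong proj₂ eq))

-- b ≺ b' : b is read before b' (lower rows first, each row from left to right).
_≺_ : Box → Box → Set
_≺_ = ×-Lex _≡_ _>_ _<_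

≺-asym : ∀ {b b'} → b ≺ b' → ¬ b' ≺ b
≺-asym = ×-asymmetric {_≈₁_ = _≡_} {_<₁_ = _>_} {_<₂_ = _<_} sym (resp₂ _>_) <-asym <-asym

≺-trans : ∀ {b b' b''} → b ≺ b' → b' ≺ b'' → b ≺ b''
≺-trans = ×-transitive {_≈₁_ = _≡_} {_<₁_ = _>_} {_<₂_ = _<_}
            isEquivalence (resp₂ _>_) (λ b>b' b'>b'' → <-trans b'>b'' b>b') <-trans

Reach-source : ∀ {S : Box → Set} {a b} → Reach S a b → S a
Reach-source (here sa)    = sa
Reach-source (step r _ _) = Reach-source r

Reach-target : ∀ {S : Box → Set} {a b} → Reach S a b → S b
Reach-target (here sa)     = sa
Reach-target (step _ _ sc) = sc

module Tableau {lam mu : List ℕ} (lam-strict : Linked _>_ lam) (mu-strict : Linked _>_ mu)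
               (Tb : Filling) (tab : IsTableau lam mu Tb) where

  open Shape lam-strict mu-strict public
  open IsTableau tab

  row-mono : ∀ {x y y'} → Skew x y → Skew x y' → y ≤ y' → Tb x y ≤L Tb x y'
  row-mono {x} {y} {y'} s s' y≤y' with m≤n⇒m<n∨m≡n y≤y'
  ... | inj₂ refl = ≤-refl
  row-mono {x} {y} {suc z} s s' _ | inj₁ (s≤s y≤z) =
    ≤-trans (row-mono s sz y≤z) (rowWeak x z (inSkew sz) (inSkew s'))
    where sz = skew-convex s s' ≤-refl ≤-refl y≤z (n≤1+n z) (≤-trans (skew-row≤col s) y≤z)

  col-mono : ∀ {x x' y} → Skew x y → Skew x' y → x ≤ x' → Tb x y ≤L Tb x' y
  col-mono {x} {x'} {y} s s' x≤x' with m≤n⇒m<n∨m≡n x≤x'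
  ... | inj₂ refl = ≤-refl
  col-mono {x} {suc z} {y} s s' _ | inj₁ (s≤s x≤z) =
    ≤-trans (col-mono s sz x≤z) (colWeak z y (inSkew sz) (inSkew s'))
    where sz = skew-convex s s' x≤z (n≤1+n z) ≤-refl ≤-refl (≤-trans (n≤1+n z) (skew-row≤col s'))

  entry-mono : ∀ {x₁ y₁ x₂ y₂} → Skew x₁ y₁ → Skew x₂ y₂ → x₁ ≤ x₂ → y₁ ≤ y₂ →
               Tb x₁ y₁ ≤L Tb x₂ y₂
  entry-mono s₁ s₂ x₁≤x₂ y₁≤y₂ = ≤-trans (row-mono s₁ corner y₁≤y₂) (col-mono corner s₂ x₁≤x₂)
    where corner = skew-convex s₁ s₂ ≤-refl x₁≤x₂ y₁≤y₂ ≤-refl (≤-trans (skew-row≤col s₁) y₁≤y₂)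

  unmarked-column-unique : ∀ {i x x' y} → Skew x y → Skew x' y →
                           Tb x y ≡ letter i false → Tb x' y ≡ letter i false → x ≡ x'
  unmarked-column-unique {x = x} {x'} {y} s s' e e' =
    unmarkedCol x x' y (inSkew s) (inSkew s') (trans e (sym e')) (cong primed e)

  marked-row-unique : ∀ {i x y y'} → Skew x y → Skew x y' →
                      Tb x y ≡ letter i true → Tb x y' ≡ letter i true → y ≡ y'
  marked-row-unique {x = x} {y} {y'} s s' e e' =
    markedRow x y y' (inSkew s) (inSkew s') (trans e (sym e')) (cong primed e)

  InLevel : ℕ → Box → Set
  InLevel i (x , y) = Skew x y × num (Tb x y) ≡ i

  Level⇒InLevel : ∀ {i b} → Level lam mu Tb i b → InLevel i b
  Level⇒InLevel (s , n) = skew s , n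

  InLevel⇒Level : ∀ {i b} → InLevel i b → Level lam mu Tb i b
  InLevel⇒Level (s , n) = inSkew s , n

  level-convex : ∀ {i x₁ y₁ x₂ y₂ x y} → InLevel i (x₁ , y₁) → InLevel i (x₂ , y₂) →
                 x₁ ≤ x → x ≤ x₂ → y₁ ≤ y → y ≤ y₂ → x ≤ y → InLevel i (x , y)
  level-convex {i} {x₁} {y₁} {x₂} {y₂} {x} {y} (s₁ , n₁) (s₂ , n₂) x₁≤x x≤x₂ y₁≤y y≤y₂ x≤y =
    s , num-squeeze {Tb x₁ y₁} {Tb x y} {Tb x₂ y₂}
          (entry-mono s₁ s x₁≤x y₁≤y) (entry-mono s s₂ x≤x₂ y≤y₂) n₁ n₂
    where s = skew-convex s₁ s₂ x₁≤x x≤x₂ y₁≤y y≤y₂ x≤y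

  level-⌝-free : ∀ {i x y} → 1 ≤ i →
                 InLevel i (x , y) → InLevel i (x , suc y) → ¬ InLevel i (suc x , suc y)
  level-⌝-free {i} {x} {y} 1≤i (s₁ , n₁) (s₂ , n₂) (s₃ , n₃) with primed (Tb x (suc y)) in p₂
  ... | false = <-irrefl (unmarked-column-unique s₂ s₃ e₂ e₃) (n<1+n x)
    where
    e₂ = letter-η n₂ p₂
    e₃ = unmarked-if-≥ 1≤i n₃ (subst (_≤L Tb (suc x) (suc y)) e₂ (col-mono s₂ s₃ (n≤1+n x)))
  ... | true = <-irrefl (marked-row-unique s₁ s₂ e₁ e₂) (n<1+n y)
    where
    e₂ = letter-η n₂ p₂
    e₁ = marked-if-≤ 1≤i n₁ (subst (Tb x y ≤L_) e₂ (row-mono s₁ s₂ (n≤1+n y)))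

  -- A step left or down out of the north-east quadrant of (u,v) either reaches (u,v-1) or (u+1,v),
  -- or completes a ⌝ with a box between the step and (u,v).
  component-NE : ∀ {i u v c} → 1 ≤ i →
                 ¬ Reach (Level lam mu Tb i) (u , v) (suc u , v) →
                 ¬ Reach (Level lam mu Tb i) (u , v) (u , v ∸ 1) →
                 Reach (Level lam mu Tb i) (u , v) c → proj₁ c ≤ u × v ≤ proj₂ c
  component-NE _ _ _ (here _) = ≤-refl , ≤-refl
  component-NE {i} {u} {v} 1≤i no-below no-left (step {b = s , t} r adj lc)
    with component-NE 1≤i no-below no-left r | adj
  ... | s≤u , v≤t | inj₁ (refl , inj₁ refl) = s≤u , m≤n⇒m≤1+n v≤t
  ... | s≤u , v≤t | inj₂ (refl , inj₂ refl) = ≤-trans (n≤1+n _) s≤u , v≤t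
  ... | s≤u , v≤t | inj₁ (refl , inj₂ refl) with m≤n⇒m<n∨m≡n v≤t
  ...   | inj₁ (s≤s v≤t') = s≤u , v≤t'
  ...   | inj₂ refl with m≤n⇒m<n∨m≡n s≤u
  ...     | inj₂ refl = ⊥-elim (no-left (step r (inj₁ (refl , inj₂ refl)) lc))
  ...     | inj₁ s<u  = ⊥-elim (level-⌝-free 1≤i (Level⇒InLevel lc) lv-b
                          (level-convex lv-b lv-uv (n≤1+n s) s<u ≤-refl ≤-refl
                            (≤-trans s<u (skew-row≤col (proj₁ lv-uv)))))
    where
    lv-b  = Level⇒InLevel (Reach-target r)
    lv-uv = Level⇒InLevel (Reach-source r)
  component-NE {i} {u} {v} 1≤i no-below no-left (step {b = s , t} r adj lc)
    | s≤u , v≤t | inj₂ (refl , inj₁ refl) with m≤n⇒m<n∨m≡n s≤u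
  ...   | inj₁ s<u  = s<u , v≤t
  ...   | inj₂ refl with m≤n⇒m<n∨m≡n v≤t
  ...     | inj₂ refl = ⊥-elim (no-below (step r (inj₂ (refl , inj₁ refl)) lc))
  ...     | inj₁ (s≤s {n = t'} v≤t') = ⊥-elim (level-⌝-free 1≤i
                          (level-convex lv-uv lv-b ≤-refl ≤-refl v≤t' (n≤1+n t')
                            (≤-trans (skew-row≤col (proj₁ lv-uv)) v≤t'))
                          lv-b (Level⇒InLevel lc))
    where
    lv-b  = Level⇒InLevel (Reach-target r)
    lv-uv = Level⇒InLevel (Reach-source r)

  lastBox-leftmost : ∀ {i u v} → 1 ≤ i → LastBox (Level lam mu Tb i) (u , v) →
                     ∀ {b} → Level lam mu Tb i b → v ≤ proj₂ b
  lastBox-leftmost 1≤i (_ , (c , reach-c , c-leftmost) , no-below , no-left) lb =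
    ≤-trans (proj₂ (component-NE 1≤i no-below no-left reach-c)) (c-leftmost _ lb)

  fitting⇒first-unmarked : ∀ {i x₀ y₀} → 1 ≤ i → Fitting lam mu Tb i → InLevel i (x₀ , y₀) →
                           (∀ {b} → InLevel i b → b ≡ (x₀ , y₀) ⊎ (x₀ , y₀) ≺ b) →
                           Tb x₀ y₀ ≡ letter i false
  fitting⇒first-unmarked {i} {x₀} {y₀} 1≤i ((u , v) , last@(l-uv , _) , Tuv≡i) lv₀ first
    with first (Level⇒InLevel l-uv)
  ... | inj₁ refl        = Tuv≡i
  ... | inj₂ (inj₁ u<x₀) = unmarked-if-≥ 1≤i (proj₂ lv₀)
    (subst (_≤L Tb x₀ y₀) Tuv≡i (entry-mono (skew (proj₁ l-uv)) (proj₁ lv₀) (<⇒≤ u<x₀)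
      (lastBox-leftmost 1≤i last (InLevel⇒Level lv₀))))
  ... | inj₂ (inj₂ (refl , y₀<v)) = ⊥-elim (<⇒≱ y₀<v (lastBox-leftmost 1≤i last (InLevel⇒Level lv₀)))

  entry : Box → Letter
  entry (x , y) = Tb x y

  rowCols : ℕ → List ℕ
  rowCols i = filter (λ j → T? (inSkewᵇ lam mu i j)) (map (i +_) (upTo (part lam i)))

  rowBoxes : ℕ → List Box
  rowBoxes i = map (i ,_) (rowCols i)

  rows : List ℕ
  rows = map suc (downFrom (length lam))

  boxes : List Box
  boxes = concatMap rowBoxes rows

  readingWord≡ : readingWord lam mu Tb ≡ map entry boxes
  readingWord≡ = sym (begin
    map entry (concatMap rowBoxes rows)   ≡⟨ map-concatMap entry rowBoxes rows ⟩
    concatMap (map entry ∘ rowBoxes) rows ≡⟨ cong concat (map-cong (λ i → sym (map-∘ (rowCols i))) rows) ⟩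
    concatMap (rowWord lam mu Tb) rows    ∎)
    where open ≡-Reasoning

  ∈boxes⇒skew : ∀ {x y} → (x , y) ∈ boxes → Skew x y
  ∈boxes⇒skew b∈ with satisfied (∈-concatMap⁻ rowBoxes {xs = rows} b∈)
  ... | r , b∈row with ∈-map⁻ (r ,_) b∈row
  ... | j , j∈ , refl =
    skew (proj₂ (∈-filter⁻ (λ j → T? (inSkewᵇ lam mu r j)) {xs = map (r +_) (upTo (part lam r))} j∈))

  skew⇒∈boxes : ∀ {x y} → Skew x y → (x , y) ∈ boxes
  skew⇒∈boxes {zero}      s = case proj₁ (skew-pos s) of λ ()
  skew⇒∈boxes {x@(suc _)} {y} s = ∈-concatMap⁺ rowBoxes (lose row∈ box∈)
    where
    open InShape (skew-inShape s)
    row∈ : x ∈ rows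
    row∈ = ∈-map⁺ suc (∈-downFrom⁺ row≤len)
    y≡ : x + (y ∸ x) ≡ y
    y≡ = m+[n∸m]≡n row≤col
    col∈ : y ∈ map (x +_) (upTo (part lam x))
    col∈ = subst (_∈ _) y≡
      (∈-map⁺ (x +_) (∈-upTo⁺ (+-cancelˡ-< x _ _ (subst (_< _) (sym y≡) col<end))))
    box∈ : (x , y) ∈ rowBoxes x
    box∈ = ∈-map⁺ (x ,_) (∈-filter⁺ (λ j → T? (inSkewᵇ lam mu x j)) col∈ (inSkew s))

  rowBoxes-row : ∀ r {b} → b ∈ rowBoxes r → proj₁ b ≡ r
  rowBoxes-row r b∈ with ∈-map⁻ (r ,_) b∈
  ... | _ , _ , refl = refl

  rowBoxes-sorted : ∀ r → AllPairs _≺_ (rowBoxes r)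
  rowBoxes-sorted r = AllPairsₚ.map⁺ (AllPairs.map (λ j<j' → inj₂ (refl , j<j'))
    (AllPairsₚ.filter⁺ _ (AllPairsₚ.map⁺ (AllPairs.map (+-monoʳ-< r)
      (AllPairsₚ.applyUpTo⁺₁ id (part lam r) (λ j<j' _ → j<j'))))))

  rows-descending : AllPairs _>_ rows
  rows-descending =
    AllPairsₚ.map⁺ (AllPairsₚ.applyDownFrom⁺₁ id (length lam) (λ j<i _ → s≤s j<i))

  boxes-sorted : AllPairs _≺_ boxes
  boxes-sorted = AllPairsₚ.concat⁺ (All-map⁺ (All.tabulate λ {r} _ → rowBoxes-sorted r))
                                   (AllPairsₚ.map⁺ (AllPairs.map lower-row-first rows-descending))
    where
    lower-row-first : ∀ {r r'} → r > r' → All (λ b → All (b ≺_) (rowBoxes r')) (rowBoxes r)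
    lower-row-first {r} {r'} r>r' = All.tabulate λ b∈ → All.tabulate λ b'∈ →
      inj₁ (subst₂ _>_ (sym (rowBoxes-row r b∈)) (sym (rowBoxes-row r' b'∈)) r>r')

  boxes-unique : Unique boxes
  boxes-unique = AllPairs⇒Unique ≺-asym boxes-sorted

  module Around {pre q post} (split : boxes ≡ pre ++ q ∷ post) where

    sorted : AllPairs _≺_ (pre ++ q ∷ post)
    sorted = subst (AllPairs _≺_) split boxes-sorted

    in-boxes : ∀ {r} → r ∈ pre ++ q ∷ post → r ∈ boxes
    in-boxes = subst (_ ∈_) (sym split)

    pivot-skew : Skew (proj₁ q) (proj₂ q)
    pivot-skew = ∈boxes⇒skew (in-boxes (∈-++⁺ʳ pre (here refl)))

    in-post : ∀ {r} → r ∈ boxes → q ≺ r → r ∈ post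
    in-post r∈ = ∈-after-pivot ≺-asym pre sorted (subst (_ ∈_) split r∈)

    in-pre : ∀ {r} → r ∈ boxes → r ≺ q → r ∈ pre
    in-pre r∈ = ∈-before-pivot ≺-asym pre sorted (subst (_ ∈_) split r∈)

    post-after : ∀ {r} → r ∈ post → q ≺ r
    post-after = All.lookup (AllPairs-after-pivot pre sorted)

    pre-before : ∀ {r} → r ∈ pre → r ≺ q
    pre-before = All.lookup (AllPairs-before-pivot pre sorted)

    pre-unique : Unique pre
    pre-unique = AllPairs⇒Unique ≺-asym (proj₁ (AllPairs-++⁻ pre sorted))

    post-unique : Unique post
    post-unique = AllPairs⇒Unique ≺-asym (AllPairs.tail (proj₂ (AllPairs-++⁻ pre sorted)))

  first-unmarked : ∀ {i l} → 1 ≤ i → Fitting lam mu Tb i →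
                   firstWith (isNum i) (map entry boxes) ≡ just l → primed l ≡ false
  first-unmarked {i} 1≤i fit found with firstWith-map (isNum i) entry boxes found
  ... | pre , q , post , split , entry-q≡l , none-before =
    cong primed (trans (sym entry-q≡l) (fitting⇒first-unmarked 1≤i fit (pivot-skew , num-q) first))
    where
    open Around split
    num-q : num (entry q) ≡ i
    num-q = isNum⁻ (entry q)
      (subst (T ∘ isNum i) (sym entry-q≡l) (firstWith-holds (isNum i) (map entry boxes) found))
    first : ∀ {b} → InLevel i b → b ≡ q ⊎ q ≺ b
    first (s , n) with ∈-++⁻ pre (subst (_ ∈_) split (skew⇒∈boxes s))
    ... | inj₁ b∈pre          = ⊥-elim (All.lookup none-before b∈pre (isNum⁺ (entry _) n))
    ... | inj₂ (here refl)    = inj₁ refl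
    ... | inj₂ (there b∈post) = inj₂ (post-after b∈post)

  module WithConditions {a : ℕ} (1≤a : 1 ≤ a) (C : Conditions (suc a) lam mu Tb) where

    open Conditions C

    k : ℕ
    k = suc a

    above-marked-k : ∀ {x y} → Skew x y → Tb x y ≡ letter a true →
                     Skew (suc x) (suc y) → Tb (suc x) (suc y) ≡ letter k true →
                     Skew x (suc y) × (Tb x (suc y) ≡ letter a false ⊎ Tb x (suc y) ≡ letter k true)
    above-marked-k {x} {y} s-diag diag≡a' s k' = s-up , between-marked lo hi ≢a'
      where
      s-up = skew-convex s-diag s ≤-refl (n≤1+n x) (n≤1+n y) ≤-refl
               (m≤n⇒m≤1+n (skew-row≤col s-diag))
      lo = subst (_≤L Tb x (suc y)) diag≡a' (row-mono s-diag s-up (n≤1+n y))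
      hi = subst (Tb x (suc y) ≤L_) k' (col-mono s-up s (n≤1+n x))
      ≢a' : Tb x (suc y) ≢ letter a true
      ≢a' up≡a' = <-irrefl (marked-row-unique s-diag s-up diag≡a' up≡a') (n<1+n y)

    unmarked-a-above-marked : ∀ {x y} → Skew x y → Tb x y ≡ letter k true →
                              ∃[ z ] (z < x × Skew z y × Tb z y ≡ letter a false)
    unmarked-a-above-marked {zero}  s _ = case proj₁ (skew-pos s) of λ ()
    unmarked-a-above-marked {suc x} {zero} s _ = case proj₂ (skew-pos s) of λ ()
    unmarked-a-above-marked {suc x} {suc y} s k' with cond3 (suc x) (suc y) (inSkew s) k'
    ... | s-diag , diag≡a' with above-marked-k (skew s-diag) diag≡a' s k'
    ... | s-up , inj₁ up≡a  = x , n<1+n x , s-up , up≡a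
    ... | s-up , inj₂ up≡k' with unmarked-a-above-marked s-up up≡k'
    ... | z , z<x , s-z , z≡a = z , m<n⇒m<1+n z<x , s-z , z≡a

    unmarked-a-above : ∀ {x y} → Skew x y → num (Tb x y) ≡ k →
                       ∃[ z ] (z < x × Skew z y × Tb z y ≡ letter a false)
    unmarked-a-above {x} {y} s n with primed (Tb x y) in p
    ... | true  = unmarked-a-above-marked s (letter-η n p)
    ... | false with cond2 x y (inSkew s) (letter-η n p)
    ... | z , z<x , s-z , z≡a = z , z<x , skew s-z , z≡a

    no-unmarked-k-above : ∀ {x₁ x y} → Skew x₁ y → Skew x y → x₁ < x → num (Tb x y) ≡ k →
                          Tb x₁ y ≢ letter k false
    no-unmarked-k-above {y = y} s₁ s x₁<x n e₁ = <-irrefl (unmarked-column-unique s₁ s e₁ e) x₁<x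
      where e = unmarked-if-≥ (s≤s z≤n) n (subst (_≤L Tb _ y) e₁ (col-mono s₁ s (<⇒≤ x₁<x)))

    isUk isUa isMk isMa : Box → Bool
    isUk = isUnmarked k ∘ entry
    isUa = isUnmarked a ∘ entry
    isMk = isMarked k ∘ entry
    isMa = isMarked a ∘ entry

    isUk⁻ : ∀ r → T (isUk r) → entry r ≡ letter k false
    isUk⁻ r = isUnmarked⁻ {k} {entry r}

    SameColumn : Box → Box → Set
    SameColumn b b' = proj₂ b ≡ proj₂ b'

    column-matching : ∀ {xs} → (∀ {r} → r ∈ xs → r ∈ boxes) →
                      (∀ {r r'} → r ∈ xs → r' ∈ boxes → r ≺ r' → r' ∈ xs) →
                      Matching isUk isUa SameColumn xs xs
    column-matching {xs} ⊆boxes upward = record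
      { partner           = partner
      ; partner-injective = λ r∈ r'∈ uk uk' same same' →
          unique (⊆boxes r∈) (⊆boxes r'∈) uk uk' (trans same (sym same'))
      }
      where
      partner : ∀ {r} → r ∈ xs → T (isUk r) → ∃[ r' ] (r' ∈ xs × T (isUa r') × SameColumn r r')
      partner {x , y} r∈ uk with cond2 x y (inSkew (∈boxes⇒skew (⊆boxes r∈))) (isUk⁻ (x , y) uk)
      ... | z , z<x , s-z , z≡a =
        (z , y) , upward r∈ (skew⇒∈boxes (skew s-z)) (inj₁ z<x) , isUnmarked⁺ z≡a , refl
      unique : ∀ {r r'} → r ∈ boxes → r' ∈ boxes → T (isUk r) → T (isUk r') →
               SameColumn r r' → r ≡ r'
      unique {x , y} {x' , .y} r∈ r'∈ uk uk' refl = cong (_, y)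
        (unmarked-column-unique (∈boxes⇒skew r∈) (∈boxes⇒skew r'∈) (isUk⁻ (x , y) uk) (isUk⁻ (x' , y) uk'))

    unmarked-gap : suc (count isUk boxes) ≤ count isUa boxes
    unmarked-gap with cond1
    ... | xₑ , yₑ , sₑ , e≡a , no-k-below =
      count-< boxes-unique (column-matching id (λ _ r'∈ _ → r'∈))
              (skew⇒∈boxes (skew sₑ)) (isUnmarked⁺ e≡a) unrelated
      where
      unrelated : ∀ {r} → r ∈ boxes → T (isUk r) → ¬ SameColumn r (xₑ , yₑ)
      unrelated {x , .yₑ} r∈ uk refl with <-cmp x xₑ
      ... | tri< x<xₑ _ _ = 1+n≰n (num-mono {letter k false} {letter a false} (subst₂ _≤L_
                              (isUk⁻ (x , yₑ) uk) e≡a (col-mono (∈boxes⇒skew r∈) (skew sₑ) (<⇒≤ x<xₑ))))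
      ... | tri≈ _ refl _ = 1+n≢n (cong num (trans (sym (isUk⁻ (x , yₑ) uk)) e≡a))
      ... | tri> _ _ x>xₑ = no-k-below x x>xₑ (inSkew (∈boxes⇒skew r∈)) (isUk⁻ (x , yₑ) uk)

    suffix-gap : ∀ {pre q post} → boxes ≡ pre ++ q ∷ post → num (entry q) ≡ k →
                 suc (count isUk post) ≤ count isUa post
    suffix-gap {pre} {q} {post} split nq with unmarked-a-above (Around.pivot-skew split) nq
    ... | z , z<x , s-z , z≡a =
      count-< post-unique (column-matching (in-boxes ∘ ∈-++⁺ʳ pre ∘ there) upward)
              (in-post (skew⇒∈boxes s-z) (inj₁ z<x)) (isUnmarked⁺ z≡a) unrelated
      where
      open Around split
      upward : ∀ {r r'} → r ∈ post → r' ∈ boxes → r ≺ r' → r' ∈ post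
      upward r∈ r'∈ r≺r' = in-post r'∈ (≺-trans (post-after r∈) r≺r')
      unrelated : ∀ {r} → r ∈ post → T (isUk r) → ¬ SameColumn r (z , proj₂ q)
      unrelated {x , _} r∈ uk refl with post-after r∈
      ... | inj₁ x<xq        = no-unmarked-k-above (∈boxes⇒skew (in-boxes (∈-++⁺ʳ pre (there r∈))))
                                 pivot-skew x<xq nq (isUk⁻ (x , proj₂ q) uk)
      ... | inj₂ (_ , yq<yq) = <-irrefl refl yq<yq

    Diagonal : Box → Box → Set
    Diagonal (x , y) r = (x ∸ 1 , y ∸ 1) ≡ r

    prefix-bound : ∀ {pre q post} → boxes ≡ pre ++ q ∷ post →
                   letter a false ≤L entry q → entry q ≤L letter k true →
                   count isMk pre ≤ count isMa pre
    prefix-bound {pre} {q} {post} split a≤q q≤k' = count-≤ pre-unique record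
      { partner           = partner
      ; partner-injective = λ r∈ r'∈ _ _ d d' →
          diagonal-injective (skew-pre r∈) (skew-pre r'∈) (trans d (sym d'))
      }
      where
      open Around split
      skew-pre : ∀ {x y} → (x , y) ∈ pre → Skew x y
      skew-pre = ∈boxes⇒skew ∘ in-boxes ∘ ∈-++⁺ˡ
      diagonal-before : ∀ {x y} → (x , y) ≺ q → Skew x y → Tb x y ≡ letter k true →
                        Skew (x ∸ 1) (y ∸ 1) → Tb (x ∸ 1) (y ∸ 1) ≡ letter a true →
                        (x ∸ 1 , y ∸ 1) ≺ q
      diagonal-before (inj₂ (refl , y<yq)) s k' _ _ =
        ⊥-elim (<-irrefl (marked-row-unique s pivot-skew k' q≡k') y<yq)
        where
        q≡k' = sym (≤L-antisym {letter k true} {entry q} (s≤s z≤n)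
                      (subst (_≤L entry q) k' (row-mono s pivot-skew (<⇒≤ y<yq))) q≤k')
      diagonal-before {suc x} {y} (inj₁ (s≤s xq≤x)) _ _ s-d d≡a' with m≤n⇒m<n∨m≡n xq≤x
      ... | inj₁ xq<x = inj₁ xq<x
      ... | inj₂ refl with proj₂ q ≤? y ∸ 1
      ...   | no  yq≰ = inj₂ (refl , ≰⇒> yq≰)
      ...   | yes yq≤ = ⊥-elim (<⇒≱ (marked<unmarked 1≤a)
                          (≤-trans a≤q (subst (entry q ≤L_) d≡a' (row-mono pivot-skew s-d yq≤))))
      partner : ∀ {r} → r ∈ pre → T (isMk r) → ∃[ r' ] (r' ∈ pre × T (isMa r') × Diagonal r r')
      partner {x , y} r∈ mk with isMarked⁻ {k} {Tb x y} mk
      ... | k' with cond3 x y (inSkew (skew-pre r∈)) k'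
      ... | s-d , d≡a' = (x ∸ 1 , y ∸ 1) ,
        in-pre (skew⇒∈boxes (skew s-d))
               (diagonal-before (pre-before r∈) (skew-pre r∈) k' (skew s-d) d≡a') ,
        isMarked⁺ d≡a' , refl

    word : List Letter
    word = map entry boxes

    suffix-condition : ∀ j → j < length word → mcount word k j ≡ mcount word a j →
                       num (at word (length word ∸ j)) ≢ k
    suffix-condition j j<n balanced numk = <-irrefl counts-equal (suffix-gap split nq)
      where
      open PivotAt (pivotAt entry boxes (length word ∸ suc j) (∸suc< j<n))
      position : length word ∸ j ≡ suc (length word ∸ suc j)
      position = ∸≡suc∸suc j<n
      nq : num (entry pivot) ≡ k
      nq = trans (cong num (sym (trans (cong (at word) position) at≡))) numk
      suffix-count : ∀ i → mcount word i j ≡ count (isUnmarked i ∘ entry) after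
      suffix-count i = begin
        mcount word i j
          ≡⟨ mcount-suffix word i (<⇒≤ j<n) ⟩
        countᵇ (isUnmarked i) (drop (length word ∸ j) word)
          ≡⟨ cong (λ m → countᵇ (isUnmarked i) (drop m word)) position ⟩
        countᵇ (isUnmarked i) (drop (suc (length word ∸ suc j)) word)
          ≡⟨ cong (countᵇ (isUnmarked i)) drop≡ ⟩
        countᵇ (isUnmarked i) (map entry after)
          ≡⟨ countᵇ-map (isUnmarked i) entry after ⟩
        count (isUnmarked i ∘ entry) after
          ∎
        where open ≡-Reasoning
      counts-equal : count isUk after ≡ count isUa after
      counts-equal = trans (sym (suffix-count k)) (trans balanced (suffix-count a))

    prefix-condition : ∀ j → length word ≤ j → j < 2 * length word →
                       mcount word k j ≡ mcount word a j →
                       (at word (suc (j ∸ length word)) ≢ letter a false) ×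
                       (at word (suc (j ∸ length word)) ≢ letter k true)
    prefix-condition j n≤j j<2n balanced =
      (λ e → unbalanced (inj₁ (trans (sym at≡) e))) , (λ e → unbalanced (inj₂ (trans (sym at≡) e)))
      where
      open PivotAt (pivotAt entry boxes (j ∸ length word) (∸<-of-<2* n≤j j<2n))
      prefix-count : ∀ i → mcount word i j ≡
                           count (isUnmarked i ∘ entry) boxes + count (isMarked i ∘ entry) before
      prefix-count i = begin
        mcount word i j
          ≡⟨ mcount-prefix word i n≤j ⟩
        countᵇ (isUnmarked i) word + countᵇ (isMarked i) (take (j ∸ length word) word)
          ≡⟨ cong (countᵇ (isUnmarked i) word +_) (cong (countᵇ (isMarked i)) take≡) ⟩
        countᵇ (isUnmarked i) word + countᵇ (isMarked i) (map entry before)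
          ≡⟨ cong₂ _+_ (countᵇ-map (isUnmarked i) entry boxes) (countᵇ-map (isMarked i) entry before) ⟩
        count (isUnmarked i ∘ entry) boxes + count (isMarked i ∘ entry) before
          ∎
        where open ≡-Reasoning
      unbalanced : entry pivot ≡ letter a false ⊎ entry pivot ≡ letter k true → ⊥
      unbalanced pivot-a-or-k' =
        <-irrefl (trans (sym (prefix-count k)) (trans balanced (prefix-count a)))
          (+-mono-≤ unmarked-gap
            (uncurry (prefix-bound split) (between-unmarked-next-marked pivot-a-or-k')))

    amenable : Amenable k word
    amenable = record
      { condA = suffix-condition
      ; condB = prefix-condition
      ; condC = λ _ found → first-unmarked (s≤s z≤n) (cond5 (content-pos found)) found
      ; condD = λ _ → first-unmarked 1≤a cond4
      }
      where
      content-pos : ∀ {l} → firstWith (isNum k) word ≡ just l → 0 < content lam mu Tb k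
      content-pos found = subst (λ v → 0 < countᵇ (isNum k) v) (sym readingWord≡)
                                (firstWith⇒countᵇ>0 (isNum k) word found)

corollary2p22 : (lam mu : List ℕ) → IsDP lam → IsDP mu → mu ⊆D lam →
                (k : ℕ) → 2 ≤ k → (Tb : Filling) → IsTableau lam mu Tb →
                ((content lam mu Tb k ≡ 0 × content lam mu Tb (k ∸ 1) ≡ 0)
                  ⊎ Conditions k lam mu Tb) →
                TabAmenable k lam mu Tb
corollary2p22 lam mu _ _ _ k _ Tb _ (inj₁ (no-k , no-k-1)) =
  amenable-if-absent k (readingWord lam mu Tb) no-k no-k-1
corollary2p22 lam mu (lam-strict , _) (mu-strict , _) _ (suc (suc a)) (s≤s (s≤s z≤n)) Tb tab (inj₂ C) =
  subst (Amenable (suc (suc a))) (sym readingWord≡) amenable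
  where
  open Tableau lam-strict mu-strict Tb tab
  open WithConditions (s≤s z≤n) C
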